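{- For every prime power $q$ and all integers $n,t\ge 2$, \[ \chi_q(t;n) \le \left\lceil \frac{n}{t-1} \right\rceil . \]
   Context: For a prime power $q$ and integer $n\ge1$, $\mathrm{PG}(n-1,q)$ is the projective space whose points are the $1$-dimensional subspaces of $\mathbb{F}_q^n$; a $(t-1)$-dimensional projective subspace is the set of points contained in a $t$-dimensional linear subspace of $\mathbb{F}_q^n$. For an integer $t\ge 2$, $\chi_q(t;n)$ denotes the minimum number of colors needed to color the points of $\mathrm{PG}(n-1,q)$ so that no $(t-1)$-dimensional projective subspace is monochromatic (all its points receiving the same color). In particular, if $n\le t-1$ there is no such subspace and $\chi_q(t;n)=1$. -}

module Defs where

open import Level using (0ℓ)
open import Algebra.Bundles using (CommutativeRing)
open import Data.Nat using (ℕ; zero; suc; _+_; _^_; _≤_; _∸_)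
open import Data.Nat.DivMod using (_/_)
open import Data.Nat.Primality using (Prime)
open import Data.Fin using (Fin; zero; suc)
open import Data.Product using (Σ; ∃; _×_; _,_)
open import Relation.Nullary using (¬_)
open import Relation.Binary.PropositionalEquality using (_≡_; _≢_)

IsPrimePower : ℕ → Set
IsPrimePower q = ∃ λ p → ∃ λ m → Prime p × 1 ≤ m × q ≡ p ^ m

-- ceiling division; ⌈ m / d ⌉ for d ≥ 1 (value 0 for d = 0, never used)
ceilDiv : ℕ → ℕ → ℕ
ceilDiv m zero    = 0
ceilDiv m (suc d) = (m + d) / suc d

module _ (R : CommutativeRing 0ℓ 0ℓ) where
  open CommutativeRing R using (Carrier; _≈_; _*_; 0#; 1#) renaming (_+_ to _+ᴿ_)

  IsField : Set
  IsField = (¬ (1# ≈ 0#)) × (∀ x → ¬ (x ≈ 0#) → ∃ λ y → x * y ≈ 1#)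

  HasOrder : ℕ → Set
  HasOrder q = Σ (Fin q → Carrier) λ e →
      (∀ x → ∃ λ i → e i ≈ x) × (∀ i j → e i ≈ e j → i ≡ j)

  ∑ : ∀ {m} → (Fin m → Carrier) → Carrier
  ∑ {zero}  f = 0#
  ∑ {suc m} f = f zero +ᴿ ∑ (λ i → f (suc i))

  Vecₙ : ℕ → Set
  Vecₙ n = Fin n → Carrier

  IsZeroVec : ∀ {n} → Vecₙ n → Set
  IsZeroVec v = ∀ i → v i ≈ 0#

  lincomb : ∀ {n t} → (Fin t → Carrier) → (Fin t → Vecₙ n) → Vecₙ n
  lincomb a b i = ∑ (λ j → a j * b j i)

  LinIndep : ∀ {n t} → (Fin t → Vecₙ n) → Set
  LinIndep {n} {t} b = ∀ (a : Fin t → Carrier) → IsZeroVec (lincomb a b) → ∀ j → a j ≈ 0#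

  -- A k-coloring of the points of PG(n-1,F): a map on vectors of F^n that is
  -- constant on each projective point, i.e. invariant under nonzero scaling
  -- (its value on the zero vector is irrelevant).
  record PointColoring (n k : ℕ) : Set where
    field
      colour    : Vecₙ n → Fin k
      projective : ∀ (v w : Vecₙ n) (λ′ : Carrier) → ¬ (λ′ ≈ 0#) →
                   (∀ i → w i ≈ λ′ * v i) → colour v ≡ colour w

  -- The (t-1)-dimensional projective subspace spanned by the linearly independent
  -- vectors b₀,…,b_{t-1} consists of the points ⟨Σ a_j b_j⟩ with Σ a_j b_j ≠ 0.
  -- It is monochromatic if all these points have the same colour.
  Monochromatic : ∀ {n k t} → PointColoring n k → (Fin t → Vecₙ n) → Set
  Monochromatic {t = t} c b =
    ∀ (a a′ : Fin t → Carrier) →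
      ¬ IsZeroVec (lincomb a b) → ¬ IsZeroVec (lincomb a′ b) →
      PointColoring.colour c (lincomb a b) ≡ PointColoring.colour c (lincomb a′ b)

  ChiAtMost : (t n k : ℕ) → Set
  ChiAtMost t n k = Σ (PointColoring n k) λ c →
    ∀ (b : Fin t → Vecₙ n) → LinIndep b → ¬ Monochromatic c b

{-# OPTIONS --safe #-}

-- Split the n coordinates into consecutive blocks of d = t - 1 and colour a point by the
-- block holding its first nonzero coordinate; this uses ⌈n/d⌉ colours. If every point of
-- the span V of t independent vectors had colour c, all of V would vanish before block c.
-- But t vectors restricted to the d coordinates of block c are linearly dependent, so some
-- nonzero vector of V also vanishes on block c, and its colour exceeds c.
module Submission where

open import Defs
open import Level using (0ℓ)
open import Algebra.Bundles using (CommutativeRing)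
open import Data.Nat as ℕ using (ℕ; zero; suc; _≤_; _<_; _∸_; z≤n; s≤s; NonZero)
open import Data.Nat.Properties as ℕ
  using ( ≤-trans; ≤-reflexive; <-≤-trans; <⇒≱; n<1+n; +-monoˡ-≤; +-cancelʳ-≤; ∸-monoˡ-<
        ; m+n∸m≡n; m+[n∸m]≡n; ≮⇒≥; _<?_; module ≤-Reasoning)
open import Data.Nat.DivMod
  using (_/_; _%_; m≡m%n+[m/n]*n; m%n<n; m*n/n≡m; m/n*n≤m; /-monoˡ-≤; m<n*o⇒m/o<n)
open import Data.Fin using (Fin; zero; suc; toℕ; fromℕ<)
open import Data.Fin.Properties as Fin using (toℕ<n; toℕ-fromℕ<; fromℕ<-cong; fromℕ<-injective; any?)
open import Data.Fin.Permutation using (Permutation′; _⟨$⟩ʳ_; _⟨$⟩ˡ_; inverseʳ; transpose)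
open import Data.Vec.Functional using (_∷_; tail)
open import Data.Product using (∃; _×_; _,_; proj₁; proj₂)
open import Function using (_∘_; _⇔_; mk⇔; Equivalence)
open import Relation.Nullary using (¬_; yes; no; ¬?; contradiction)
open import Relation.Nullary.Decidable using (map′; decidable-stable)
open import Relation.Binary.Definitions using (Decidable)
open import Relation.Binary.PropositionalEquality as ≡ using (_≡_)

m≤ceilDiv[m,n]*n : ∀ m n .{{_ : NonZero n}} → m ≤ ceilDiv m n ℕ.* n
m≤ceilDiv[m,n]*n m n@(suc d) = +-cancelʳ-≤ d m (q ℕ.* n) (begin
  m ℕ.+ d                       ≡⟨ m≡m%n+[m/n]*n (m ℕ.+ d) n ⟩
  (m ℕ.+ d) % n ℕ.+ q ℕ.* n     ≤⟨ +-monoˡ-≤ (q ℕ.* n) (ℕ.s≤s⁻¹ (m%n<n (m ℕ.+ d) n)) ⟩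
  d ℕ.+ q ℕ.* n                 ≡⟨ ℕ.+-comm d (q ℕ.* n) ⟩
  q ℕ.* n ℕ.+ d                 ∎)
  where
  open ≤-Reasoning
  q = ceilDiv m n

*≤⇒≤/ : ∀ {m o} n .{{_ : NonZero n}} → m ℕ.* n ≤ o → m ≤ o / n
*≤⇒≤/ {m} n m*n≤o = ≤-trans (≤-reflexive (≡.sym (m*n/n≡m m n))) (/-monoˡ-≤ n m*n≤o)

module _ (R : CommutativeRing 0ℓ 0ℓ) where
  open CommutativeRing R hiding (zero)
  open import Algebra.Properties.Monoid.Sum +-monoid using (sum; sum-cong-≋; sum-replicate-zero)
  open import Algebra.Properties.CommutativeMonoid.Sum +-commutativeMonoid
    using () renaming (∑-distrib-+ to sum-distrib-+)
  open import Algebra.Properties.Semiring.Sum semiring using (*-distribʳ-sum)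
  open import Relation.Binary.Reasoning.Setoid setoid

  ∑≡sum : ∀ {m} (f : Fin m → Carrier) → ∑ R f ≡ sum f
  ∑≡sum {zero}  f = ≡.refl
  ∑≡sum {suc m} f = ≡.cong (f zero +_) (∑≡sum (tail f))

  ∑-cong : ∀ {m} {f g : Fin m → Carrier} → (∀ j → f j ≈ g j) → ∑ R f ≈ ∑ R g
  ∑-cong {f = f} {g} f≈g rewrite ∑≡sum f | ∑≡sum g = sum-cong-≋ f≈g

  ∑-zero : ∀ {m} {f : Fin m → Carrier} → (∀ j → f j ≈ 0#) → ∑ R f ≈ 0#
  ∑-zero {m} f≈0 =
    trans (∑-cong f≈0) (trans (reflexive (∑≡sum {m} (λ _ → 0#))) (sum-replicate-zero m))

  ∑-distrib-+ : ∀ {m} (f g : Fin m → Carrier) → ∑ R (λ j → f j + g j) ≈ ∑ R f + ∑ R g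
  ∑-distrib-+ f g rewrite ∑≡sum (λ j → f j + g j) | ∑≡sum f | ∑≡sum g = sum-distrib-+ f g

  *-distribʳ-∑ : ∀ {m} (f : Fin m → Carrier) x → ∑ R f * x ≈ ∑ R (λ j → f j * x)
  *-distribʳ-∑ f x rewrite ∑≡sum f | ∑≡sum (λ j → f j * x) = *-distribʳ-sum x f

  -- Coordinates past the end read as 0#, so that a window may overhang the vector.
  coord : ∀ {n} → Vecₙ R n → ℕ → Carrier
  coord {zero}  v k       = 0#
  coord {suc n} v zero    = v zero
  coord {suc n} v (suc k) = coord (tail v) k

  coord-toℕ : ∀ {n} (v : Vecₙ R n) i → coord v (toℕ i) ≡ v i
  coord-toℕ v zero    = ≡.refl
  coord-toℕ v (suc i) = coord-toℕ (tail v) i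

  coord-lincomb : ∀ {n t} (a : Fin t → Carrier) (b : Fin t → Vecₙ R n) k →
                  coord (lincomb R a b) k ≈ ∑ R (λ j → a j * coord (b j) k)
  coord-lincomb {zero}  a b k       = sym (∑-zero (λ j → zeroʳ (a j)))
  coord-lincomb {suc n} a b zero    = refl
  coord-lincomb {suc n} a b (suc k) = coord-lincomb a (tail ∘ b) k

  window : ∀ {n d} → ℕ → Vecₙ R n → Vecₙ R d
  window m v r = coord v (m ℕ.+ toℕ r)

  VanishesBelow : ∀ {n} → ℕ → Vecₙ R n → Set
  VanishesBelow m v = ∀ i → toℕ i < m → v i ≈ 0#

  vanishesBelow-extend : ∀ {n d m} {v : Vecₙ R n} → VanishesBelow m v →
                         IsZeroVec R (window {d = d} m v) → VanishesBelow (m ℕ.+ d) v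
  vanishesBelow-extend {d = d} {m} {v} below window≈0 i i<m+d with toℕ i <? m
  ... | yes i<m = below i i<m
  ... | no  i≮m =
    ≡.subst (_≈ 0#) (coord-toℕ v i) (≡.subst (λ k → coord v k ≈ 0#) m+r≡i (window≈0 r))
    where
    m≤i = ≮⇒≥ i≮m
    r<d : toℕ i ∸ m < d
    r<d = ≡.subst (toℕ i ∸ m <_) (m+n∸m≡n m d) (∸-monoˡ-< i<m+d m≤i)
    r = fromℕ< r<d
    m+r≡i : m ℕ.+ toℕ r ≡ toℕ i
    m+r≡i = ≡.trans (≡.cong (m ℕ.+_) (toℕ-fromℕ< r<d)) (m+[n∸m]≡n m≤i)

  Nontrivial : ∀ {t} → (Fin t → Carrier) → Set
  Nontrivial a = ∃ λ j → ¬ a j ≈ 0#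

  LinDep : ∀ {n t} → (Fin t → Vecₙ R n) → Set
  LinDep b = ∃ λ a → Nontrivial a × IsZeroVec R (lincomb R a b)

  LinIndep⇒lincomb≉0 : ∀ {n t} (b : Fin t → Vecₙ R n) → LinIndep R b →
                       ∀ {a} → Nontrivial a → ¬ IsZeroVec R (lincomb R a b)
  LinIndep⇒lincomb≉0 b indep {a} (j , aⱼ≉0) a·b≈0 = aⱼ≉0 (indep a a·b≈0 j)

  LinDep-permute : ∀ {n t} (π : Permutation′ n) (v : Fin t → Vecₙ R n) →
                   LinDep (λ j → v j ∘ (π ⟨$⟩ʳ_)) → LinDep v
  LinDep-permute π v (a , a≉0 , a·vπ≈0) =
    a , a≉0 , λ i → ≡.subst (λ k → lincomb R a v k ≈ 0#) (inverseʳ π) (a·vπ≈0 (π ⟨$⟩ˡ i))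

  sweep : ∀ {n t} → (Fin t → Carrier) → (Fin (suc t) → Vecₙ R n) → Fin t → Vecₙ R n
  sweep μ v j i = v (suc j) i + μ j * v zero i

  lincomb-sweep : ∀ {n t} μ (a : Fin t → Carrier) (v : Fin (suc t) → Vecₙ R n) i →
                  lincomb R a (sweep μ v) i ≈ lincomb R (∑ R (λ j → a j * μ j) ∷ a) v i
  lincomb-sweep μ a v i = begin
    ∑ R (λ j → a j * (v (suc j) i + μ j * v zero i))
      ≈⟨ ∑-cong (λ j → trans (distribˡ (a j) _ _) (+-congˡ (sym (*-assoc (a j) (μ j) _)))) ⟩
    ∑ R (λ j → a j * v (suc j) i + a j * μ j * v zero i)
      ≈⟨ ∑-distrib-+ (λ j → a j * v (suc j) i) (λ j → a j * μ j * v zero i) ⟩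
    ∑ R (λ j → a j * v (suc j) i) + ∑ R (λ j → a j * μ j * v zero i)
      ≈⟨ +-congˡ (*-distribʳ-∑ (λ j → a j * μ j) (v zero i)) ⟨
    ∑ R (λ j → a j * v (suc j) i) + ∑ R (λ j → a j * μ j) * v zero i
      ≈⟨ +-comm _ _ ⟩
    ∑ R (λ j → a j * μ j) * v zero i + ∑ R (λ j → a j * v (suc j) i)
      ∎

  LinDep-sweep : ∀ {n t} (μ : Fin t → Carrier) (v : Fin (suc t) → Vecₙ R (suc n)) →
                 (∀ j → sweep μ v j zero ≈ 0#) → LinDep (λ j → tail (sweep μ v j)) → LinDep v
  LinDep-sweep μ v cleared (a , (j , aⱼ≉0) , a·swept≈0) =
    ∑ R (λ j → a j * μ j) ∷ a , (suc j , aⱼ≉0) ,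
    λ i → trans (sym (lincomb-sweep μ a v i)) (swept≈0 i)
    where
    swept≈0 : IsZeroVec R (lincomb R a (sweep μ v))
    swept≈0 zero    = ∑-zero (λ j → trans (*-congˡ (cleared j)) (zeroʳ (a j)))
    swept≈0 (suc i) = a·swept≈0 i

module _ (R : CommutativeRing 0ℓ 0ℓ) (isField : IsField R)
         (_≟_ : Decidable (CommutativeRing._≈_ R)) where
  open CommutativeRing R hiding (zero)
  open import Algebra.Properties.Ring ring using (-‿distribˡ-*)
  open import Relation.Binary.Reasoning.Setoid setoid

  1≉0 : ¬ 1# ≈ 0#
  1≉0 = proj₁ isField

  x*y≈0⇒y≈0 : ∀ {x y} → ¬ x ≈ 0# → x * y ≈ 0# → y ≈ 0#
  x*y≈0⇒y≈0 {x} {y} x≉0 xy≈0 with proj₂ isField x x≉0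
  ... | x⁻¹ , xx⁻¹≈1 = begin
    y               ≈⟨ *-identityʳ y ⟨
    y * 1#          ≈⟨ *-congˡ xx⁻¹≈1 ⟨
    y * (x * x⁻¹)   ≈⟨ *-assoc y x x⁻¹ ⟨
    y * x * x⁻¹     ≈⟨ *-congʳ (trans (*-comm y x) xy≈0) ⟩
    0# * x⁻¹        ≈⟨ zeroˡ x⁻¹ ⟩
    0#              ∎

  e₀ : ∀ {t} → Fin (suc t) → Carrier
  e₀ = 1# ∷ λ _ → 0#

  e₀-nontrivial : ∀ {t} → Nontrivial R (e₀ {t})
  e₀-nontrivial = zero , 1≉0

  firstZero⇒LinDep : ∀ {n t} (v : Fin (suc t) → Vecₙ R n) → IsZeroVec R (v zero) → LinDep R v
  firstZero⇒LinDep v v₀≈0 = e₀ , e₀-nontrivial , λ i →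
    trans (+-cong (trans (*-identityˡ _) (v₀≈0 i)) (∑-zero R (λ j → zeroˡ (v (suc j) i))))
          (+-identityʳ 0#)

  clearing-sweep : ∀ {n t} (v : Fin (suc t) → Vecₙ R (suc n)) → ¬ v zero zero ≈ 0# →
                   ∃ λ μ → ∀ j → sweep R μ v j zero ≈ 0#
  clearing-sweep v p≉0 with proj₂ isField (v zero zero) p≉0
  ... | p⁻¹ , pp⁻¹≈1 = (λ j → - (v (suc j) zero * p⁻¹)) , λ j → cleared (v (suc j) zero)
    where
    p = v zero zero
    cleared : ∀ y → y + - (y * p⁻¹) * p ≈ 0#
    cleared y = begin
      y + - (y * p⁻¹) * p   ≈⟨ +-congˡ (-‿distribˡ-* (y * p⁻¹) p) ⟨
      y + - (y * p⁻¹ * p)   ≈⟨ +-congˡ (-‿cong (trans (*-assoc y p⁻¹ p) (*-congˡ (*-comm p⁻¹ p)))) ⟩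
      y + - (y * (p * p⁻¹)) ≈⟨ +-congˡ (-‿cong (trans (*-congˡ pp⁻¹≈1) (*-identityʳ y))) ⟩
      y + - y               ≈⟨ -‿inverseʳ y ⟩
      0#                    ∎

  -- Gaussian elimination on the first vector: move a nonzero entry of it to coordinate 0,
  -- clear coordinate 0 of the other vectors with it, and recurse on the remaining coordinates.
  <⇒LinDep : ∀ {n t} → n < t → (v : Fin t → Vecₙ R n) → LinDep R v
  <⇒LinDep {zero}  {suc t} _ v = firstZero⇒LinDep v (λ ())
  <⇒LinDep {suc n} {suc t} (s≤s n<t) v with any? (λ i → ¬? (v zero i ≟ 0#))
  ... | no  noPivot = firstZero⇒LinDep v (λ i → decidable-stable (v zero i ≟ 0#) (noPivot ∘ (i ,_)))
  ... | yes (i , pivot≉0) =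
    LinDep-permute R π v (LinDep-sweep R μ w cleared (<⇒LinDep n<t (λ j → tail (sweep R μ w j))))
    where
    π = transpose zero i
    w = λ j → v j ∘ (π ⟨$⟩ʳ_)
    μ = proj₁ (clearing-sweep w pivot≉0)
    cleared = proj₂ (clearing-sweep w pivot≉0)

  -- Junk value: the zero vector gets the last position.
  leadingIndex : ∀ {n} → Vecₙ R (suc n) → Fin (suc n)
  leadingIndex {zero}  v = zero
  leadingIndex {suc n} v with v zero ≟ 0#
  ... | yes _ = suc (leadingIndex (tail v))
  ... | no  _ = zero

  leadingIndex-vanishesBelow : ∀ {n} (v : Vecₙ R (suc n)) → VanishesBelow R (toℕ (leadingIndex v)) v
  leadingIndex-vanishesBelow {suc n} v i i<ℓ with v zero ≟ 0#
  leadingIndex-vanishesBelow {suc n} v zero    _         | yes v₀≈0 = v₀≈0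
  leadingIndex-vanishesBelow {suc n} v (suc i) (s≤s i<ℓ) | yes _    =
    leadingIndex-vanishesBelow (tail v) i i<ℓ

  vanishesBelow⇒≤leadingIndex : ∀ {n m} {v : Vecₙ R (suc n)} → ¬ IsZeroVec R v →
                                VanishesBelow R m v → m ≤ toℕ (leadingIndex v)
  vanishesBelow⇒≤leadingIndex {m = zero} _ _ = z≤n
  vanishesBelow⇒≤leadingIndex {zero} {suc m} v≉0 below =
    contradiction (λ { zero → below zero (s≤s z≤n) }) v≉0
  vanishesBelow⇒≤leadingIndex {suc n} {suc m} {v} v≉0 below with v zero ≟ 0#
  ... | yes v₀≈0 = s≤s (vanishesBelow⇒≤leadingIndex tail≉0 (λ i → below (suc i) ∘ s≤s))
    where
    tail≉0 : ¬ IsZeroVec R (tail v)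
    tail≉0 tail≈0 = v≉0 λ { zero → v₀≈0 ; (suc i) → tail≈0 i }
  ... | no  v₀≉0 = contradiction (below zero (s≤s z≤n)) v₀≉0

  leadingIndex-cong : ∀ {n} {v w : Vecₙ R (suc n)} → (∀ i → v i ≈ 0# ⇔ w i ≈ 0#) →
                      leadingIndex v ≡ leadingIndex w
  leadingIndex-cong {zero} _ = ≡.refl
  leadingIndex-cong {suc n} {v} {w} sameZeros with v zero ≟ 0# | w zero ≟ 0#
  ... | yes _     | yes _     = ≡.cong suc (leadingIndex-cong (sameZeros ∘ suc))
  ... | yes v₀≈0  | no  w₀≉0  = contradiction (Equivalence.to (sameZeros zero) v₀≈0) w₀≉0
  ... | no  v₀≉0  | yes w₀≈0  = contradiction (Equivalence.from (sameZeros zero) w₀≈0) v₀≉0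
  ... | no  _     | no  _     = ≡.refl

  scaling-preservesZeros : ∀ {n} {v w : Vecₙ R n} {c} → ¬ c ≈ 0# → (∀ i → w i ≈ c * v i) →
                           ∀ i → v i ≈ 0# ⇔ w i ≈ 0#
  scaling-preservesZeros {c = c} c≉0 w≈cv i = mk⇔
    (λ vᵢ≈0 → trans (w≈cv i) (trans (*-congˡ vᵢ≈0) (zeroʳ c)))
    (λ wᵢ≈0 → x*y≈0⇒y≈0 c≉0 (trans (sym (w≈cv i)) wᵢ≈0))

  module BlockColouring (d : ℕ) .{{_ : NonZero d}} {n k : ℕ} (n≤kd : suc n ≤ k ℕ.* d) where

    block : Vecₙ R (suc n) → ℕ
    block v = toℕ (leadingIndex v) / d

    block<k : ∀ v → block v < k
    block<k v = m<n*o⇒m/o<n (<-≤-trans (toℕ<n (leadingIndex v)) n≤kd)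

    colouring : PointColoring R (suc n) k
    colouring = record
      { colour     = λ v → fromℕ< (block<k v)
      ; projective = λ v w c c≉0 w≈cv → fromℕ<-cong _ _
          (≡.cong (λ i → toℕ i / d) (leadingIndex-cong (scaling-preservesZeros c≉0 w≈cv))) _ _
      }

    vanishesBelow-block : ∀ v → VanishesBelow R (block v ℕ.* d) v
    vanishesBelow-block v i i<bd =
      leadingIndex-vanishesBelow v i (<-≤-trans i<bd (m/n*n≤m (toℕ (leadingIndex v)) d))

    block-nonconstant : ∀ (b : Fin (suc d) → Vecₙ R (suc n)) → LinIndep R b →
                        ∀ c → ¬ (∀ {a} → Nontrivial R a → block (lincomb R a b) ≡ c)
    block-nonconstant b indep c sameBlock with <⇒LinDep (n<1+n d) (λ j → window R (c ℕ.* d) (b j))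
    ... | a , a≉0 , a·window≈0 =
      <⇒≱ (n<1+n c) (≡.subst (suc c ≤_) (sameBlock a≉0) (*≤⇒≤/ d [c+1]d≤ℓ))
      where
      w = lincomb R a b
      below-cd : VanishesBelow R (c ℕ.* d) w
      below-cd = ≡.subst (λ x → VanishesBelow R (x ℕ.* d) w) (sameBlock a≉0) (vanishesBelow-block w)
      window≈0 : IsZeroVec R (window R (c ℕ.* d) w)
      window≈0 r = trans (coord-lincomb R a b (c ℕ.* d ℕ.+ toℕ r)) (a·window≈0 r)
      [c+1]d≤ℓ : suc c ℕ.* d ≤ toℕ (leadingIndex w)
      [c+1]d≤ℓ = ≡.subst (_≤ toℕ (leadingIndex w)) (ℕ.+-comm (c ℕ.* d) d)
        (vanishesBelow⇒≤leadingIndex (LinIndep⇒lincomb≉0 R b indep a≉0)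
                                     (vanishesBelow-extend R below-cd window≈0))

    no-monochromatic : ∀ (b : Fin (suc d) → Vecₙ R (suc n)) → LinIndep R b →
                       ¬ Monochromatic R colouring b
    no-monochromatic b indep mono = block-nonconstant b indep _ λ {a} a≉0 →
      fromℕ<-injective _ _ _ _
        (mono a e₀ (LinIndep⇒lincomb≉0 R b indep a≉0) (LinIndep⇒lincomb≉0 R b indep e₀-nontrivial))

    chiAtMost : ChiAtMost R (suc d) (suc n) k
    chiAtMost = colouring , no-monochromatic

HasOrder⇒decidable : ∀ (F : CommutativeRing 0ℓ 0ℓ) {q} → HasOrder F q →
                     Decidable (CommutativeRing._≈_ F)
HasOrder⇒decidable F (e , onto , injective) x y = map′
  (λ iₓ≡iᵧ → trans (sym (proj₂ (onto x))) (trans (reflexive (≡.cong e iₓ≡iᵧ)) (proj₂ (onto y))))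
  (λ x≈y → injective _ _ (trans (proj₂ (onto x)) (trans x≈y (sym (proj₂ (onto y))))))
  (proj₁ (onto x) Fin.≟ proj₁ (onto y))
  where open CommutativeRing F

theorem1p3 : (q : ℕ) → IsPrimePower q →
    (F : CommutativeRing 0ℓ 0ℓ) → IsField F → HasOrder F q →
    (n t : ℕ) → 2 ≤ n → 2 ≤ t →
    ChiAtMost F t n (ceilDiv n (t ∸ 1))
theorem1p3 _ _ F isField order (suc n) (suc (suc d)) (s≤s _) (s≤s (s≤s _)) =
  BlockColouring.chiAtMost F isField (HasOrder⇒decidable F order) (suc d)
    (m≤ceilDiv[m,n]*n (suc n) (suc d))
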